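{- Let $h,t$ be positive integers with $h\ge t$, $n=ht$, and $0\le s\le n$ an integer. Let $x_a=\frac{t-h}{2}-(a-1)$, $y_a=\frac{t+h}{2}-a$ ($a=1,\dots,t$) be the segments of $\mathrm{Speh}(h,t)$, and put $\underline x_a:=\ell(x_a)$, $\underline y_a:=\ell(y_a+1)$. Let $d=\gcd(n,s)$ and $m=n/d$. The following are equivalent: (i) for each $\rho\in\mathbb Q/\mathbb Z$, the number of indices $a$ with $\rho(\underline x_a)=\rho$ equals the number of indices $a$ with $\rho(\underline y_a)=\rho$; (ii) $m$ divides $t$ or $m$ divides $h$.
   Context: $\ell\subset\mathbb Q^2$ is the line through the origin of slope $s/n$ and $\ell(x)=(x,\tfrac snx)$. For $\underline v\in\mathbb Q^2$, its invariant $\rho(\underline v)\in\mathbb Q/\mathbb Z$ is the class of its second coordinate modulo $\mathbb Z$; thus $\rho(\ell(x))=\tfrac snx\bmod\mathbb Z$. -}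

module Defs where

open import Data.Nat as ℕ using (ℕ; zero; suc; NonZero; _≡ᵇ_)
import Data.Nat.Properties as ℕP
import Data.Nat.DivMod as ℕD
open import Data.Nat.GCD using (gcd; gcd[m,n]≢0)
open import Data.Integer as ℤ using (ℤ; +_)
open import Data.Rational as ℚ using (ℚ; _/_; _*_; _-_; _+_)
open import Data.Fin using (Fin; toℕ)
open import Data.Product using (_×_; _,_; proj₂)
open import Data.Sum using (inj₁)
open import Data.Bool using (Bool; if_then_else_)

nonZero-* : ∀ h t → .{{NonZero h}} → .{{NonZero t}} → NonZero (h ℕ.* t)
nonZero-* h t = ℕP.m*n≢0 h t

slope : (h t s : ℕ) → .{{NonZero h}} → .{{NonZero t}} → ℚ
slope h t s = (+ s) / (h ℕ.* t)
  where instance _ = nonZero-* h t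

ℓ : (h t s : ℕ) → .{{NonZero h}} → .{{NonZero t}} → ℚ → ℚ × ℚ
ℓ h t s x = x , slope h t s * x

-- ρ(v) : second coordinate, a representative of its class in ℚ/ℤ
ρ : ℚ × ℚ → ℚ
ρ v = proj₂ v

-- p and q define the same class in ℚ/ℤ  iff  p - q is an integer
sameClass : ℚ → ℚ → Bool
sameClass p q = ℚ.denominatorℕ (p - q) ≡ᵇ 1

count : (k : ℕ) → (Fin k → Bool) → ℕ
count zero    P = 0
count (suc k) P = (if P Fin.zero then 1 else 0) ℕ.+ count k (λ i → P (Fin.suc i))

-- segments of Speh(h,t); the index a = 1..t is represented by i : Fin t with a = toℕ i + 1
-- x_a = (t-h)/2 - (a-1)
xSeg : (h t : ℕ) → Fin t → ℚ
xSeg h t i = ((+ t ℤ.- + h) / 2) - ((+ toℕ i) / 1)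

ySeg : (h t : ℕ) → Fin t → ℚ
ySeg h t i = ((+ t ℤ.+ + h) / 2) - ((+ (suc (toℕ i))) / 1)

mOf : (h t s : ℕ) → .{{NonZero h}} → .{{NonZero t}} → ℕ
mOf h t s = ℕD._/_ (h ℕ.* t) (gcd (h ℕ.* t) s)
  {{ℕ.≢-nonZero (gcd[m,n]≢0 (h ℕ.* t) s (inj₁ (ℕ.≢-nonZero⁻¹ (h ℕ.* t) {{nonZero-* h t}})))}}

module Submission where

-- Write σ = s/n and X k = σ·x_{k+1}, Y k = σ·(y_{k+1} + 1) for the two families of
-- second coordinates.  Reducing σ = s'/m to lowest terms, the class of X k in ℚ/ℤ
-- depends only on k mod m, and X a, X b lie in one class exactly when m ∣ b - a.
-- Moreover Y k - X (J + k) = σ·(h + J), which is an integer for J = (m - 1)·h, so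
-- the y-points occupy the classes of the x-points translated by J.
--
-- The theorem therefore reduces to a purely combinatorial statement, proved first:
-- for an m-periodic partition of ℕ into classes whose members are m apart, every
-- class meets [0, t) and [J, J + t) equally often iff m ∣ t or m ∣ J.  Counts over
-- full periods agree, so only the remainder windows [0, t mod m) and its translate
-- matter, and for 0 < t mod m, J mod m < m a boundary point of one of these windows
-- has a class absent from the other.  Finally m ∣ J ⇔ m ∣ h because m ∣ h + J.

module Counting where

  open import Data.Nat using (ℕ; zero; suc; _+_; _*_; _<_; z<s; s<s; NonZero; _%_; _/_)
  open import Data.Nat.Properties
  open import Data.Nat.DivMod using (m≡m%n+[m/n]*n)
  open import Data.Bool using (Bool; true; false; if_then_else_)
  open import Data.Empty using (⊥; ⊥-elim)
  open import Data.Fin using (toℕ)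
  open import Function.Bundles using (_⇔_; mk⇔)
  open import Relation.Binary.PropositionalEquality
  open import Defs using (count)

  indicator : Bool → ℕ
  indicator b = if b then 1 else 0

  countBelow : ℕ → (ℕ → Bool) → ℕ
  countBelow zero    F = 0
  countBelow (suc L) F = indicator (F 0) + countBelow L (λ k → F (suc k))

  count≡countBelow : ∀ t F → count t (λ a → F (toℕ a)) ≡ countBelow t F
  count≡countBelow zero    F = refl
  count≡countBelow (suc t) F = cong (indicator (F 0) +_) (count≡countBelow t (λ k → F (suc k)))

  countBelow-ext : ∀ L {F G : ℕ → Bool} → (∀ k → F k ≡ G k) → countBelow L F ≡ countBelow L G
  countBelow-ext zero    F≗G = refl
  countBelow-ext (suc L) F≗G =
    cong₂ _+_ (cong indicator (F≗G 0)) (countBelow-ext L (λ k → F≗G (suc k)))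

  countBelow-+ : ∀ L M F → countBelow (L + M) F ≡ countBelow L F + countBelow M (λ k → F (L + k))
  countBelow-+ zero    M F = refl
  countBelow-+ (suc L) M F =
    trans (cong (indicator (F 0) +_) (countBelow-+ L M (λ k → F (suc k))))
          (sym (+-assoc (indicator (F 0)) _ _))

  countBelow-snoc : ∀ L F → countBelow (suc L) F ≡ countBelow L F + indicator (F L)
  countBelow-snoc L F = begin
    countBelow (suc L) F                         ≡⟨ cong (λ n → countBelow n F) (+-comm 1 L) ⟩
    countBelow (L + 1) F                         ≡⟨ countBelow-+ L 1 F ⟩
    countBelow L F + (indicator (F (L + 0)) + 0) ≡⟨ cong (countBelow L F +_) (+-identityʳ _) ⟩
    countBelow L F + indicator (F (L + 0))       ≡⟨ cong (λ n → countBelow L F + indicator (F n)) (+-identityʳ L) ⟩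
    countBelow L F + indicator (F L)             ∎
    where open ≡-Reasoning

  countBelow-pos : ∀ L F k → k < L → F k ≡ true → 0 < countBelow L F
  countBelow-pos (suc L) F zero    _         F0 rewrite F0 = z<s
  countBelow-pos (suc L) F (suc k) (s<s k<L) Fk =
    <-≤-trans (countBelow-pos L (λ k → F (suc k)) k k<L Fk) (m≤n+m _ (indicator (F 0)))

  countBelow-none : ∀ L F → (∀ k → k < L → F k ≡ true → ⊥) → countBelow L F ≡ 0
  countBelow-none zero    F none = refl
  countBelow-none (suc L) F none with F 0 in F0
  ... | true  = ⊥-elim (none 0 z<s F0)
  ... | false = countBelow-none L (λ k → F (suc k)) (λ k k<L → none (suc k) (s<s k<L))

  Periodic : ℕ → (ℕ → Bool) → Set
  Periodic m F = ∀ k → F (m + k) ≡ F k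

  periodic-multiple : ∀ {m F} → Periodic m F → ∀ q k → F (q * m + k) ≡ F k
  periodic-multiple         per zero    k = refl
  periodic-multiple {m} {F} per (suc q) k =
    trans (cong F (+-assoc m (q * m) k)) (trans (per (q * m + k)) (periodic-multiple per q k))

  periodic-shift : ∀ {m F} → Periodic m F → ∀ j → Periodic m (λ k → F (j + k))
  periodic-shift {m} {F} per j k =
    trans (cong F (trans (sym (+-assoc j m k)) (trans (cong (_+ k) (+-comm j m)) (+-assoc m j k))))
          (per (j + k))

  countBelow-rotate : ∀ L G → G L ≡ G 0 → countBelow L (λ k → G (suc k)) ≡ countBelow L G
  countBelow-rotate L G ends = +-cancelˡ-≡ (indicator (G 0)) _ _ (begin
    indicator (G 0) + countBelow L (λ k → G (suc k)) ≡⟨ countBelow-snoc L G ⟩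
    countBelow L G + indicator (G L)                 ≡⟨ cong (λ b → countBelow L G + indicator b) ends ⟩
    countBelow L G + indicator (G 0)                 ≡⟨ +-comm (countBelow L G) _ ⟩
    indicator (G 0) + countBelow L G                 ∎)
    where open ≡-Reasoning

  countBelow-window : ∀ {m F} → Periodic m F → ∀ j → countBelow m (λ k → F (j + k)) ≡ countBelow m F
  countBelow-window         per zero    = refl
  countBelow-window {m} {F} per (suc j) = begin
    countBelow m (λ k → F (suc j + k)) ≡⟨ countBelow-ext m (λ k → cong F (+-suc j k)) ⟨
    countBelow m (λ k → F (j + suc k)) ≡⟨ countBelow-rotate m (λ k → F (j + k)) ends ⟩
    countBelow m (λ k → F (j + k))     ≡⟨ countBelow-window per j ⟩
    countBelow m F                     ∎
    where
    open ≡-Reasoning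
    ends : F (j + m) ≡ F (j + 0)
    ends = trans (cong F (+-comm j m)) (trans (per j) (cong F (sym (+-identityʳ j))))

  countBelow-periods : ∀ {m F} → Periodic m F → ∀ q ρ →
    countBelow (q * m + ρ) F ≡ q * countBelow m F + countBelow ρ F
  countBelow-periods         per zero    ρ = refl
  countBelow-periods {m} {F} per (suc q) ρ = begin
    countBelow (m + q * m + ρ) F
      ≡⟨ cong (λ n → countBelow n F) (+-assoc m (q * m) ρ) ⟩
    countBelow (m + (q * m + ρ)) F
      ≡⟨ countBelow-+ m (q * m + ρ) F ⟩
    countBelow m F + countBelow (q * m + ρ) (λ k → F (m + k))
      ≡⟨ cong (countBelow m F +_) (countBelow-ext (q * m + ρ) per) ⟩
    countBelow m F + countBelow (q * m + ρ) F
      ≡⟨ cong (countBelow m F +_) (countBelow-periods per q ρ) ⟩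
    countBelow m F + (q * countBelow m F + countBelow ρ F)
      ≡⟨ +-assoc (countBelow m F) _ _ ⟨
    suc q * countBelow m F + countBelow ρ F ∎
    where open ≡-Reasoning

  countBelow-agree-mod : ∀ m .{{_ : NonZero m}} {F G} → Periodic m F → Periodic m G →
    countBelow m F ≡ countBelow m G → ∀ t →
    countBelow t F ≡ countBelow t G ⇔ countBelow (t % m) F ≡ countBelow (t % m) G
  countBelow-agree-mod m {F} {G} perF perG period t = mk⇔
    (λ eq → +-cancelˡ-≡ (q * countBelow m F) _ _ (begin
      q * countBelow m F + countBelow ρ F ≡⟨ splitF ⟨
      countBelow t F                      ≡⟨ eq ⟩
      countBelow t G                      ≡⟨ splitG ⟩
      q * countBelow m G + countBelow ρ G ≡⟨ cong (λ c → q * c + countBelow ρ G) period ⟨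
      q * countBelow m F + countBelow ρ G ∎))
    (λ eq → begin
      countBelow t F                      ≡⟨ splitF ⟩
      q * countBelow m F + countBelow ρ F ≡⟨ cong₂ (λ c d → q * c + d) period eq ⟩
      q * countBelow m G + countBelow ρ G ≡⟨ splitG ⟨
      countBelow t G                      ∎)
    where
    open ≡-Reasoning
    q = t / m
    ρ = t % m
    t≡ : t ≡ q * m + ρ
    t≡ = trans (m≡m%n+[m/n]*n t m) (+-comm ρ (q * m))
    splitF : countBelow t F ≡ q * countBelow m F + countBelow ρ F
    splitF = trans (cong (λ n → countBelow n F) t≡) (countBelow-periods perF q ρ)
    splitG : countBelow t G ≡ q * countBelow m G + countBelow ρ G
    splitG = trans (cong (λ n → countBelow n G) t≡) (countBelow-periods perG q ρ)

module ShiftedCounting where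

  open Counting
  open import Data.Nat using (ℕ; suc; _+_; _*_; _<_; _≤_; z<s; s<s; s≤s; NonZero; _%_; _/_)
  open import Data.Nat.Properties
  open import Data.Nat.DivMod using (m≡m%n+[m/n]*n; m%n<n)
  open import Data.Nat.Divisibility using (_∣_; divides; _∣?_; >⇒∤; m%n≡0⇒n∣m; n∣m⇒m%n≡0)
  open import Data.Nat.Tactic.RingSolver using (solve-∀)
  open import Data.Bool using (Bool; true)
  open import Data.Product using (Σ; _,_; proj₁; proj₂)
  open import Data.Sum using (_⊎_; inj₁; inj₂)
  open import Data.Empty using (⊥; ⊥-elim)
  open import Relation.Nullary using (yes; no)
  open import Relation.Binary.PropositionalEquality
  open import Function.Bundles using (_⇔_; mk⇔; Equivalence)

  -- Points 0, 1, 2, … are sorted into classes: `cls r k` says that point k lies in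
  -- class r, and `pt a` is the class of point a.
  module ShiftedClasses {R : Set} (m : ℕ) .{{_ : NonZero m}}
    (cls : R → ℕ → Bool) (pt : ℕ → R)
    (periodic : ∀ r → Periodic m (cls r))
    (own : ∀ a → cls (pt a) a ≡ true)
    (apartʳ : ∀ a D → cls (pt a) (D + a) ≡ true → m ∣ D)
    (apartˡ : ∀ a D → cls (pt (D + a)) a ≡ true → m ∣ D)
    where

    isolatedʳ : ∀ a D → 0 < D → D < m → cls (pt a) (D + a) ≡ true → ⊥
    isolatedʳ a D@(suc _) _ D<m same = >⇒∤ D<m (apartʳ a D same)

    isolatedˡ : ∀ a D → 0 < D → D < m → cls (pt (D + a)) a ≡ true → ⊥
    isolatedˡ a D@(suc _) _ D<m same = >⇒∤ D<m (apartˡ a D same)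

    -- a window [0, ρ) and its translate [J, J + ρ), with 0 < ρ, J < m, are told
    -- apart by the count of some class: the class of the last point of [0, ρ) if
    -- ρ ≤ J, and the class of the point ρ ∈ [J, J + ρ) otherwise
    window-separates : ∀ ρ J → 0 < ρ → ρ < m → 0 < J → J < m →
      Σ R λ r → countBelow ρ (cls r) ≡ countBelow ρ (λ k → cls r (J + k)) → ⊥
    window-separates ρ J ρ>0 ρ<m J>0 J<m with ρ ≤? J
    window-separates (suc ρ') J _ _ J>0 J<m | yes ρ≤J = pt ρ' , λ eq →
      <-irrefl refl (subst (0 <_) (trans eq shifted-none)
                                  (countBelow-pos (suc ρ') (cls (pt ρ')) ρ' ≤-refl (own ρ')))
      where
      e = proj₁ (m≤n⇒∃[o]m+o≡n ρ≤J)
      J≡ : suc ρ' + e ≡ J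
      J≡ = proj₂ (m≤n⇒∃[o]m+o≡n ρ≤J)
      position : ∀ k → J + k ≡ suc (e + k) + ρ'
      position k = subst (λ j → j + k ≡ suc (e + k) + ρ') J≡ (rearrange ρ' e k)
        where
        rearrange : ∀ ρ' e k → suc ρ' + e + k ≡ suc (e + k) + ρ'
        rearrange = solve-∀
      distance< : ∀ k → k < suc ρ' → suc (e + k) < m
      distance< k (s≤s k≤ρ') = ≤-<-trans
        (subst (suc (e + k) ≤_) (trans (cong suc (+-comm e ρ')) J≡) (s≤s (+-monoʳ-≤ e k≤ρ')))
        J<m
      shifted-none : countBelow (suc ρ') (λ k → cls (pt ρ') (J + k)) ≡ 0
      shifted-none = countBelow-none _ _ λ k k<ρ same →
        isolatedʳ ρ' (suc (e + k)) z<s (distance< k k<ρ)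
          (subst (λ p → cls (pt ρ') p ≡ true) (position k) same)
    window-separates ρ J _ ρ<m J>0 _ | no ρ≰J = pt ρ , λ eq →
      <-irrefl refl (subst (0 <_) (trans (sym eq) unshifted-none)
                                  (countBelow-pos ρ (λ k → cls (pt ρ) (J + k)) (suc e) e<ρ shifted-own))
      where
      e = proj₁ (m≤n⇒∃[o]m+o≡n (≰⇒> ρ≰J))
      ρ≡ : suc J + e ≡ ρ
      ρ≡ = proj₂ (m≤n⇒∃[o]m+o≡n (≰⇒> ρ≰J))
      e<ρ : suc e < ρ
      e<ρ = subst (suc e <_) ρ≡ (s<s (m<n+m e J>0))
      shifted-own : cls (pt ρ) (J + suc e) ≡ true
      shifted-own = subst (λ p → cls (pt ρ) p ≡ true) (sym (trans (+-suc J e) ρ≡)) (own ρ)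
      unshifted-none : countBelow ρ (cls (pt ρ)) ≡ 0
      unshifted-none = countBelow-none _ _ λ k k<ρ same →
        let (d , k+d≡ρ) = m≤n⇒∃[o]m+o≡n k<ρ
            ρ≡d+k = trans (sym k+d≡ρ) (cong suc (+-comm k d))
        in isolatedˡ k (suc d) z<s
             (≤-<-trans (subst (suc d ≤_) k+d≡ρ (s≤s (m≤n+m d k))) ρ<m)
             (subst (λ p → cls (pt p) k ≡ true) ρ≡d+k same)

    shift-mod : ∀ r J k → cls r (J + k) ≡ cls r (J % m + k)
    shift-mod r J k = begin
      cls r (J + k)                     ≡⟨ cong (λ j → cls r (j + k)) (m≡m%n+[m/n]*n J m) ⟩
      cls r (J % m + (J / m) * m + k)   ≡⟨ cong (cls r) (rearrange (J % m) ((J / m) * m) k) ⟩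
      cls r ((J / m) * m + (J % m + k)) ≡⟨ periodic-multiple (periodic r) (J / m) (J % m + k) ⟩
      cls r (J % m + k)                 ∎
      where
      open ≡-Reasoning
      rearrange : ∀ a b c → a + b + c ≡ b + (a + c)
      rearrange = solve-∀

    shift-theorem : ∀ t J →
      (∀ r → countBelow t (cls r) ≡ countBelow t (λ k → cls r (J + k))) ⇔ (m ∣ t ⊎ m ∣ J)
    shift-theorem t J = mk⇔ forward backward
      where
      -- the counts over a full period agree, so only the remainder windows matter
      reduce : ∀ r → countBelow t (cls r) ≡ countBelow t (λ k → cls r (J + k)) ⇔
        countBelow (t % m) (cls r) ≡ countBelow (t % m) (λ k → cls r (J + k))
      reduce r = countBelow-agree-mod m (periodic r) (periodic-shift (periodic r) J)
        (sym (countBelow-window (periodic r) J)) t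

      backward : m ∣ t ⊎ m ∣ J → ∀ r → countBelow t (cls r) ≡ countBelow t (λ k → cls r (J + k))
      backward (inj₁ m∣t) r = Equivalence.from (reduce r) empty-remainders
        where
        empty-remainders : countBelow (t % m) (cls r) ≡ countBelow (t % m) (λ k → cls r (J + k))
        empty-remainders rewrite n∣m⇒m%n≡0 t m m∣t = refl
      backward (inj₂ (divides q refl)) r =
        countBelow-ext t (λ k → sym (periodic-multiple (periodic r) q k))

      forward : (∀ r → countBelow t (cls r) ≡ countBelow t (λ k → cls r (J + k))) → m ∣ t ⊎ m ∣ J
      forward equal with m ∣? t | m ∣? J
      ... | yes m∣t | _       = inj₁ m∣t
      ... | no _    | yes m∣J = inj₂ m∣J
      ... | no m∤t  | no m∤J  = ⊥-elim (differs (trans (Equivalence.to (reduce r) (equal r))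
                                          (countBelow-ext (t % m) (shift-mod r J))))
        where
        separation = window-separates (t % m) (J % m)
          (n≢0⇒n>0 (λ t%m≡0 → m∤t (m%n≡0⇒n∣m t m t%m≡0))) (m%n<n t m)
          (n≢0⇒n>0 (λ J%m≡0 → m∤J (m%n≡0⇒n∣m J m J%m≡0))) (m%n<n J m)
        r = proj₁ separation
        differs = proj₂ separation

module RationalClasses where

  open import Data.Nat as ℕ using (suc; NonZero)
  import Data.Nat.Properties as ℕ
  open import Data.Nat.Divisibility using (_∣_; divides)
  open import Data.Nat.Coprimality using (Coprime; coprime-divisor)
  open import Data.Integer as ℤ using (ℤ; +_)
  import Data.Integer.Properties as ℤ
  import Data.Integer.GCD as ℤ
  open import Data.Integer.Tactic.RingSolver using (solve-∀)
  open import Data.Rational as ℚ using (ℚ; mkℚ; _/_; _*_; _-_; _+_; -_; fromℚᵘ)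
  import Data.Rational.Properties as ℚ
  open import Data.Rational.Unnormalised as ℚᵘ using (mkℚᵘ; *≡*)
  import Data.Rational.Unnormalised.Properties as ℚᵘ
  open import Data.Rational.Solver using (module +-*-Solver)
  open import Data.Bool using (true)
  open import Data.Bool.Properties using (T-≡; ⇔→≡)
  open import Data.Product using (Σ; _,_)
  open import Function.Bundles using (_⇔_; mk⇔; Equivalence)
  open import Relation.Binary.PropositionalEquality
  open import Defs using (sameClass)
  open +-*-Solver

  fromℚᵘ-homo-+ : ∀ p q → fromℚᵘ (p ℚᵘ.+ q) ≡ fromℚᵘ p + fromℚᵘ q
  fromℚᵘ-homo-+ p q = ℚ.toℚᵘ-injective (ℚᵘ.≃-sym (ℚᵘ.≃-trans (ℚ.toℚᵘ-homo-+ (fromℚᵘ p) (fromℚᵘ q))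
    (ℚᵘ.≃-trans (ℚᵘ.+-cong (ℚ.toℚᵘ-fromℚᵘ p) (ℚ.toℚᵘ-fromℚᵘ q)) (ℚᵘ.≃-sym (ℚ.toℚᵘ-fromℚᵘ (p ℚᵘ.+ q))))))

  fromℚᵘ-homo-* : ∀ p q → fromℚᵘ (p ℚᵘ.* q) ≡ fromℚᵘ p * fromℚᵘ q
  fromℚᵘ-homo-* p q = ℚ.toℚᵘ-injective (ℚᵘ.≃-sym (ℚᵘ.≃-trans (ℚ.toℚᵘ-homo-* (fromℚᵘ p) (fromℚᵘ q))
    (ℚᵘ.≃-trans (ℚᵘ.*-cong (ℚ.toℚᵘ-fromℚᵘ p) (ℚ.toℚᵘ-fromℚᵘ q)) (ℚᵘ.≃-sym (ℚ.toℚᵘ-fromℚᵘ (p ℚᵘ.* q))))))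

  fromℚᵘ-homo‿- : ∀ p → fromℚᵘ (ℚᵘ.- p) ≡ - fromℚᵘ p
  fromℚᵘ-homo‿- p = ℚ.toℚᵘ-injective (ℚᵘ.≃-sym (ℚᵘ.≃-trans (ℚ.toℚᵘ-homo‿- (fromℚᵘ p))
    (ℚᵘ.≃-trans (ℚᵘ.-‿cong (ℚ.toℚᵘ-fromℚᵘ p)) (ℚᵘ.≃-sym (ℚ.toℚᵘ-fromℚᵘ (ℚᵘ.- p))))))

  fraction-cross : ∀ a b n k .{{_ : NonZero n}} .{{_ : NonZero k}} →
    a ℤ.* + k ≡ b ℤ.* + n → a / n ≡ b / k
  fraction-cross a b (suc n) (suc k) eq = ℚ.fromℚᵘ-cong {mkℚᵘ a n} {mkℚᵘ b k} (*≡* eq)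

  ι : ℤ → ℚ
  ι z = z / 1

  ι-+ : ∀ a b → ι (a ℤ.+ b) ≡ ι a + ι b
  ι-+ a b = trans (ℚ.fromℚᵘ-cong {mkℚᵘ (a ℤ.+ b) 0} {mkℚᵘ a 0 ℚᵘ.+ mkℚᵘ b 0} (*≡* (sym (cross a b))))
                  (fromℚᵘ-homo-+ (mkℚᵘ a 0) (mkℚᵘ b 0))
    where
    cross : ∀ a b → (a ℤ.* + 1 ℤ.+ b ℤ.* + 1) ℤ.* + 1 ≡ (a ℤ.+ b) ℤ.* + 1
    cross = solve-∀

  ι-neg : ∀ a → ι (ℤ.- a) ≡ - ι a
  ι-neg a = fromℚᵘ-homo‿- (mkℚᵘ a 0)

  Integral : ℚ → Set
  Integral q = Σ ℤ λ z → q ≡ ι z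

  Integral-+ : ∀ {p q} → Integral p → Integral q → Integral (p + q)
  Integral-+ (a , refl) (b , refl) = a ℤ.+ b , sym (ι-+ a b)

  Integral-neg : ∀ {p} → Integral p → Integral (- p)
  Integral-neg (a , refl) = ℤ.- a , sym (ι-neg a)

  Integral-swap : ∀ p q → Integral (p - q) → Integral (q - p)
  Integral-swap p q int = subst Integral (negate-difference p q) (Integral-neg int)
    where
    negate-difference : ∀ p q → - (p - q) ≡ q - p
    negate-difference = solve 2 (λ p q → :- (p :- q) := q :- p) refl

  denominator-ι : ∀ z → ℚ.denominatorℕ (ι z) ≡ 1
  denominator-ι z = ℕ.m*n≡1⇒m≡1 _ ℤ.∣ ℤ.gcd z (+ 1) ∣
    (trans (sym (ℤ.abs-* (ℚ.denominator (ι z)) (ℤ.gcd z (+ 1)))) (cong ℤ.∣_∣ (ℚ.↧-/ z 1)))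

  denominator-1⇒Integral : ∀ p → ℚ.denominatorℕ p ≡ 1 → Integral p
  denominator-1⇒Integral (mkℚ n 0 c) refl = n , sym (ℚ.↥p/↧p≡p (mkℚ n 0 c))

  sameClass⇔Integral : ∀ p q → sameClass p q ≡ true ⇔ Integral (p - q)
  sameClass⇔Integral p q = mk⇔
    (λ same → denominator-1⇒Integral (p - q) (ℕ.≡ᵇ⇒≡ _ 1 (Equivalence.from T-≡ same)))
    (λ { (z , p-q≡z) → cong (ℕ._≡ᵇ 1) (trans (cong ℚ.denominatorℕ p-q≡z) (denominator-ι z)) })

  sameClass-refl : ∀ p → sameClass p p ≡ true
  sameClass-refl p = Equivalence.from (sameClass⇔Integral p p) (+ 0 , ℚ.+-inverseʳ p)

  sameClass-shift : ∀ p q r → Integral (p - q) → sameClass p r ≡ sameClass q r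
  sameClass-shift p q r int = ⇔→≡ {z = true} (mk⇔
    (λ same → from (sameClass⇔Integral q r)
      (subst Integral (telescope p q r) (Integral-+ (to (sameClass⇔Integral p r) same) (Integral-swap p q int))))
    (λ same → from (sameClass⇔Integral p r)
      (subst Integral (telescope q p r) (Integral-+ (to (sameClass⇔Integral q r) same) int))))
    where
    open Equivalence
    telescope : ∀ p q r → (p - r) + (q - p) ≡ q - r
    telescope = solve 3 (λ p q r → (p :- r) :+ (q :- p) := q :- r) refl

  fraction-integral : ∀ a n .{{_ : NonZero n}} D → Coprime n a →
    Integral ((+ a / n) * ι (+ D)) ⇔ n ∣ D
  fraction-integral a n@(suc k) D coprime = mk⇔
    (λ { (z , eq) → coprime-divisor coprime (divides ℤ.∣ z ∣ (clear-denominator z (trans (sym product) eq))) })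
    (λ { (divides q refl) → + (a ℕ.* q) , trans product (multiple-of-n q) })
    where
    product : ∀ {D} → (+ a / n) * ι (+ D) ≡ + (a ℕ.* D) / n
    product {D} = trans (sym (fromℚᵘ-homo-* (mkℚᵘ (+ a) k) (mkℚᵘ (+ D) 0)))
      (ℚ.fromℚᵘ-cong {mkℚᵘ (+ a) k ℚᵘ.* mkℚᵘ (+ D) 0} {mkℚᵘ (+ (a ℕ.* D)) k}
        (*≡* (cong₂ ℤ._*_ (sym (ℤ.pos-* a D)) (cong +_ (sym (ℕ.*-identityʳ n))))))
    clear-denominator : ∀ z → + (a ℕ.* D) / n ≡ ι z → a ℕ.* D ≡ ℤ.∣ z ∣ ℕ.* n
    clear-denominator z eq = begin
      a ℕ.* D                    ≡⟨ cong ℤ.∣_∣ (ℤ.*-identityʳ (+ (a ℕ.* D))) ⟨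
      ℤ.∣ + (a ℕ.* D) ℤ.* + 1 ∣  ≡⟨ cong ℤ.∣_∣ (ℚᵘ.drop-*≡* (ℚ.fromℚᵘ-injective {mkℚᵘ (+ (a ℕ.* D)) k} {mkℚᵘ z 0} eq)) ⟩
      ℤ.∣ z ℤ.* + n ∣            ≡⟨ ℤ.abs-* z (+ n) ⟩
      ℤ.∣ z ∣ ℕ.* n              ∎
      where open ≡-Reasoning
    multiple-of-n : ∀ q → + (a ℕ.* (q ℕ.* n)) / n ≡ ι (+ (a ℕ.* q))
    multiple-of-n q = fraction-cross (+ (a ℕ.* (q ℕ.* n))) (+ (a ℕ.* q)) n 1 (begin
      + (a ℕ.* (q ℕ.* n)) ℤ.* + 1 ≡⟨ ℤ.*-identityʳ _ ⟩
      + (a ℕ.* (q ℕ.* n))         ≡⟨ cong +_ (ℕ.*-assoc a q n) ⟨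
      + (a ℕ.* q ℕ.* n)           ≡⟨ ℤ.pos-* (a ℕ.* q) n ⟩
      + (a ℕ.* q) ℤ.* + n         ∎)
      where open ≡-Reasoning

  half-sum-minus-half-difference : ∀ u v → (u ℤ.+ v) / 2 - (u ℤ.- v) / 2 ≡ ι v
  half-sum-minus-half-difference u v = begin
    (u ℤ.+ v) / 2 - (u ℤ.- v) / 2
      ≡⟨ cong (λ w → (u ℤ.+ v) / 2 + w) (fromℚᵘ-homo‿- (mkℚᵘ (u ℤ.- v) 1)) ⟨
    (u ℤ.+ v) / 2 + fromℚᵘ (ℚᵘ.- mkℚᵘ (u ℤ.- v) 1)
      ≡⟨ fromℚᵘ-homo-+ (mkℚᵘ (u ℤ.+ v) 1) (ℚᵘ.- mkℚᵘ (u ℤ.- v) 1) ⟨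
    fromℚᵘ (mkℚᵘ (u ℤ.+ v) 1 ℚᵘ.+ ℚᵘ.- mkℚᵘ (u ℤ.- v) 1)
      ≡⟨ ℚ.fromℚᵘ-cong {mkℚᵘ (u ℤ.+ v) 1 ℚᵘ.+ ℚᵘ.- mkℚᵘ (u ℤ.- v) 1} {mkℚᵘ v 0} (*≡* (cross u v)) ⟩
    ι v ∎
    where
    open ≡-Reasoning
    cross : ∀ u v → ((u ℤ.+ v) ℤ.* + 2 ℤ.+ ℤ.- (u ℤ.- v) ℤ.* + 2) ℤ.* + 1 ≡ v ℤ.* + 4
    cross = solve-∀

module SpehSegments where

  open Counting
  open ShiftedCounting
  open RationalClasses
  open import Defs
  open import Data.Nat as ℕ using (ℕ; suc; NonZero; _∸_)
  import Data.Nat.Properties as ℕ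
  import Data.Nat.Tactic.RingSolver as ℕ-Solver
  open import Data.Nat.Divisibility using (_∣_; ∣-refl; ∣m+n∣m⇒∣n; m∣m*n)
  open import Data.Nat.GCD using (gcd; gcd[m,n]∣m; gcd[m,n]∣n; gcd[m,n]≢0; m/gcd[m,n]≢0)
  open import Data.Nat.Coprimality using (coprime-/gcd)
  open import Data.Nat.DivMod using (m*[n/m]≡n)
  open import Data.Integer as ℤ using (+_)
  import Data.Integer.Properties as ℤ
  open import Data.Rational as ℚ using (ℚ; _/_; _*_; _-_; _+_)
  open import Data.Rational.Solver using (module +-*-Solver)
  open import Data.Fin using (toℕ)
  open import Data.Bool using (Bool; true)
  open import Data.Sum using (inj₁)
  open import Function.Bundles using (_⇔_; mk⇔; Equivalence)
  open import Relation.Binary.PropositionalEquality hiding (J)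
  open +-*-Solver

  complement-multiple : ∀ m .{{_ : NonZero m}} h → h ℕ.+ (m ∸ 1) ℕ.* h ≡ m ℕ.* h
  complement-multiple (suc m) h = refl

  ∣-complement : ∀ {m h x} → m ∣ h ℕ.+ x → m ∣ x ⇔ m ∣ h
  ∣-complement {m} {h} {x} m∣h+x = mk⇔
    (∣m+n∣m⇒∣n (subst (m ∣_) (ℕ.+-comm h x) m∣h+x))
    (∣m+n∣m⇒∣n m∣h+x)

  -- the coordinates of the points ℓ(x_a) and ℓ(y_a + 1) of Speh(h,t), indexed by k = a - 1
  module SegmentPoints (h t s : ℕ) .{{_ : NonZero h}} .{{_ : NonZero t}} where

    σ : ℚ
    σ = slope h t s

    X : ℕ → ℚ
    X k = σ * ((+ t ℤ.- + h) / 2 - ι (+ k))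

    Y : ℕ → ℚ
    Y k = σ * (((+ t ℤ.+ + h) / 2 - ι (+ suc k)) + ι (+ 1))

    X-difference : ∀ a D → X a - X (D ℕ.+ a) ≡ σ * ι (+ D)
    X-difference a D = trans (cong (λ d → X a - σ * (A - d)) (ι-+ (+ D) (+ a))) (rearrange σ A (ι (+ a)) (ι (+ D)))
      where
      A = (+ t ℤ.- + h) / 2
      rearrange : ∀ σ A a D → σ * (A - a) - σ * (A - (D + a)) ≡ σ * D
      rearrange = solve 4 (λ σ A a D → σ :* (A :- a) :- σ :* (A :- (D :+ a)) := σ :* D) refl

    Y-difference : ∀ k j → Y k - X (j ℕ.+ k) ≡ σ * ι (+ (h ℕ.+ j))
    Y-difference k j = begin
      Y k - X (j ℕ.+ k)
        ≡⟨ cong₂ (λ o d → σ * ((B - o) + ι (+ 1)) - σ * (A - d)) (ι-+ (+ 1) (+ k)) (ι-+ (+ j) (+ k)) ⟩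
      σ * ((B - (ι (+ 1) + ι (+ k))) + ι (+ 1)) - σ * (A - (ι (+ j) + ι (+ k)))
        ≡⟨ rearrange σ A B (ι (+ 1)) (ι (+ j)) (ι (+ k)) ⟩
      σ * ((B - A) + ι (+ j))
        ≡⟨ cong (λ w → σ * (w + ι (+ j))) (half-sum-minus-half-difference (+ t) (+ h)) ⟩
      σ * (ι (+ h) + ι (+ j))
        ≡⟨ cong (σ *_) (ι-+ (+ h) (+ j)) ⟨
      σ * ι (+ (h ℕ.+ j)) ∎
      where
      open ≡-Reasoning
      A = (+ t ℤ.- + h) / 2
      B = (+ t ℤ.+ + h) / 2
      rearrange : ∀ σ A B o j k → σ * ((B - (o + k)) + o) - σ * (A - (j + k)) ≡ σ * ((B - A) + j)
      rearrange = solve 6 (λ σ A B o j k → σ :* ((B :- (o :+ k)) :+ o) :- σ :* (A :- (j :+ k))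
                                         := σ :* ((B :- A) :+ j)) refl

    N : ℕ
    N = h ℕ.* t

    instance
      N≢0 : NonZero N
      N≢0 = nonZero-* h t
      gcd≢0 : NonZero (gcd N s)
      gcd≢0 = ℕ.≢-nonZero (gcd[m,n]≢0 N s (inj₁ (ℕ.≢-nonZero⁻¹ N)))
      m≢0 : NonZero (mOf h t s)
      m≢0 = ℕ.≢-nonZero (m/gcd[m,n]≢0 N s)

    m s' : ℕ
    m = mOf h t s
    s' = s ℕ./ gcd N s

    slope-reduced : σ ≡ + s' / m
    slope-reduced = fraction-cross (+ s) (+ s') N m (begin
      + s ℤ.* + m               ≡⟨ ℤ.pos-* s m ⟨
      + (s ℕ.* m)               ≡⟨ cong (λ x → + (x ℕ.* m)) (m*[n/m]≡n (gcd[m,n]∣n N s)) ⟨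
      + (gcd N s ℕ.* s' ℕ.* m)  ≡⟨ cong +_ (cross (gcd N s) s' m) ⟩
      + (s' ℕ.* (gcd N s ℕ.* m)) ≡⟨ cong (λ x → + (s' ℕ.* x)) (m*[n/m]≡n (gcd[m,n]∣m N s)) ⟩
      + (s' ℕ.* N)              ≡⟨ ℤ.pos-* s' N ⟩
      + s' ℤ.* + N              ∎)
      where
      open ≡-Reasoning
      cross : ∀ g s' m → g ℕ.* s' ℕ.* m ≡ s' ℕ.* (g ℕ.* m)
      cross = ℕ-Solver.solve-∀

    σ-integral : ∀ D → Integral (σ * ι (+ D)) ⇔ m ∣ D
    σ-integral D = subst (λ q → Integral (q * ι (+ D)) ⇔ m ∣ D) (sym slope-reduced)
      (fraction-integral s' m D (coprime-/gcd N s))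

    inClass : ℚ → ℕ → Bool
    inClass r k = sameClass (X k) r

    X-periodic : ∀ r → Periodic m (inClass r)
    X-periodic r k = sameClass-shift (X (m ℕ.+ k)) (X k) r
      (Integral-swap (X k) (X (m ℕ.+ k))
        (subst Integral (sym (X-difference k m)) (Equivalence.from (σ-integral m) ∣-refl)))

    X-apartʳ : ∀ a D → inClass (X a) (D ℕ.+ a) ≡ true → m ∣ D
    X-apartʳ a D same = Equivalence.to (σ-integral D)
      (subst Integral (X-difference a D)
        (Integral-swap (X (D ℕ.+ a)) (X a) (Equivalence.to (sameClass⇔Integral (X (D ℕ.+ a)) (X a)) same)))

    X-apartˡ : ∀ a D → inClass (X (D ℕ.+ a)) a ≡ true → m ∣ D
    X-apartˡ a D same = Equivalence.to (σ-integral D)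
      (subst Integral (X-difference a D) (Equivalence.to (sameClass⇔Integral (X a) (X (D ℕ.+ a))) same))

    open ShiftedClasses m inClass X X-periodic (λ a → sameClass-refl (X a)) X-apartʳ X-apartˡ
      using (shift-theorem) public

    -- translating the x-points by J = (m - 1)·h lands them in the classes of the y-points
    J : ℕ
    J = (m ∸ 1) ℕ.* h

    m∣h+J : m ∣ h ℕ.+ J
    m∣h+J = subst (m ∣_) (sym (complement-multiple m h)) (m∣m*n h)

    Y-class : ∀ r k → sameClass (Y k) r ≡ inClass r (J ℕ.+ k)
    Y-class r k = sameClass-shift (Y k) (X (J ℕ.+ k)) r
      (subst Integral (sym (Y-difference k J)) (Equivalence.from (σ-integral (h ℕ.+ J)) m∣h+J))

    counts-as-translates :
      ((r : ℚ) → count t (λ a → sameClass (X (toℕ a)) r) ≡ count t (λ a → sameClass (Y (toℕ a)) r))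
      ⇔ (∀ r → countBelow t (inClass r) ≡ countBelow t (λ k → inClass r (J ℕ.+ k)))
    counts-as-translates = mk⇔
      (λ equal r → trans (sym (x-counts r)) (trans (equal r) (y-counts r)))
      (λ equal r → trans (x-counts r) (trans (equal r) (sym (y-counts r))))
      where
      x-counts : ∀ r → count t (λ a → sameClass (X (toℕ a)) r) ≡ countBelow t (inClass r)
      x-counts r = count≡countBelow t (inClass r)
      y-counts : ∀ r → count t (λ a → sameClass (Y (toℕ a)) r) ≡ countBelow t (λ k → inClass r (J ℕ.+ k))
      y-counts r = trans (count≡countBelow t (λ k → sameClass (Y k) r)) (countBelow-ext t (Y-class r))

open import Defs
open import Data.Nat using (ℕ; NonZero; _≤_; _*_)
open import Data.Nat.Divisibility using (_∣_)
open import Data.Rational using (ℚ; _/_; _+_)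
open import Data.Integer using (+_)
open import Data.Sum using (_⊎_)
open import Data.Sum.Function.Propositional using (_⊎-⇔_)
open import Function.Bundles using (_⇔_)
import Function.Properties.Equivalence as ⇔
open import Relation.Binary.PropositionalEquality using (_≡_)
open SpehSegments using (module SegmentPoints; ∣-complement)

mainTheorem9 : (h t : ℕ) → .{{_ : NonZero h}} → .{{_ : NonZero t}} → t ≤ h →
    (s : ℕ) → s ≤ h * t →
    ((r : ℚ) →
       count t (λ a → sameClass (ρ (ℓ h t s (xSeg h t a))) r)
       ≡ count t (λ a → sameClass (ρ (ℓ h t s (ySeg h t a + ((+ 1) / 1)))) r))
    ⇔ (mOf h t s ∣ t ⊎ mOf h t s ∣ h)
mainTheorem9 h t _ s _ =
  ⇔.trans counts-as-translates (⇔.trans (shift-theorem t J) (⇔.refl ⊎-⇔ ∣-complement m∣h+J))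
  where open SegmentPoints h t s
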